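{- Let $\mathcal{A}$ be a skew diagram and for each box $(i,j)$ of $\mathcal{A}$ set $H(i,j)=a$ if $(i,j)$ belongs to $nw_a(\mathcal{A})$. If $(i+1,j+1)$ is a box of $\mathcal{A}$ with $H(i+1,j+1)>1$, then $(i,j)$ is a box of $\mathcal{A}$ and $H(i+1,j+1)=H(i,j)+1$.
   Context: Skew diagrams $\lambda/\mu$ (boxes of $\lambda$ not in $\mu$, matrix coordinates). Northwest ribbons: for a skew diagram $\mathcal{A}$, $nw_1(\mathcal{A})$ is the ribbon (or, for disconnected $\mathcal{A}$, the union over connected components of the ribbons) running along the northwest border of each component from the lowest box of its leftmost column to the rightmost box of its top row, i.e. the set of boxes $(i,j)\in\mathcal{A}$ with $(i-1,j-1)\notin\mathcal{A}$; $nw_{k+1}(\mathcal{A})$ is $nw_1$ of the skew diagram obtained from $\mathcal{A}$ by removing $nw_1(\mathcal{A}),\dots,nw_k(\mathcal{A})$. Every box of $\mathcal{A}$ lies in exactly one $nw_a(\mathcal{A})$. -}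

module Defs where

open import Data.Nat using (ℕ; zero; suc; _≤_; _<_)
open import Data.List using (List; []; _∷_)
open import Data.Product using (_×_)
open import Data.Empty using (⊥)
open import Relation.Nullary using (¬_)

-- i-th part of a partition given as a list (0-indexed; 0 beyond the length)
row : List ℕ → ℕ → ℕ
row []       _       = 0
row (x ∷ _)  zero    = x
row (_ ∷ xs) (suc i) = row xs i

IsPartition : List ℕ → Set
IsPartition λ′ = ∀ i → row λ′ (suc i) ≤ row λ′ i

_⊆ᵖ_ : List ℕ → List ℕ → Set
μ ⊆ᵖ λ′ = ∀ i → row μ i ≤ row λ′ i

-- a set of boxes (matrix coordinates, 0-indexed: row i, column j)
BoxSet : Set₁
BoxSet = ℕ → ℕ → Set

Skew : List ℕ → List ℕ → BoxSet
Skew λ′ μ i j = (row μ i ≤ j) × (j < row λ′ i)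

NWNeighbour : BoxSet → BoxSet
NWNeighbour B zero    _       = ⊥
NWNeighbour B (suc i) zero    = ⊥
NWNeighbour B (suc i) (suc j) = B i j

nw₁ : BoxSet → BoxSet
nw₁ B i j = B i j × ¬ NWNeighbour B i j

-- B with nw₁,…,nw_k removed
remaining : BoxSet → ℕ → BoxSet
remaining B zero    = B
remaining B (suc k) i j = remaining B k i j × ¬ nw₁ (remaining B k) i j

-- nw_a(B) for a ≥ 1 (nw_0 is empty)
nw : BoxSet → ℕ → BoxSet
nw B zero    i j = ⊥
nw B (suc k) = nw₁ (remaining B k)

-- H(i,j) = a  :⇔  (i,j) ∈ nw_a(B)
H≡ : BoxSet → ℕ → ℕ → ℕ → Set
H≡ B i j a = nw B a i j

-- A box (i+1,j+1) of nw₂(R) is not in nw₁(R), so its northwest neighbour (i,j)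
-- lies in R; and (i,j) is not left over after removing nw₁(R), so it lies in
-- nw₁(R).  Applied to R = remaining 𝒜 k this gives H(i+1,j+1) = H(i,j) + 1.
module Submission where

open import Defs
open import Data.Nat using (ℕ; zero; suc; _<_; _≤?_; _<?_; s≤s)
open import Data.List using (List)
open import Data.Product using (Σ; _×_; _,_; proj₁)
open import Relation.Binary.Definitions using (Decidable)
open import Relation.Nullary.Decidable using (no; _×-dec_; ¬?; decidable-stable)
open import Relation.Binary.PropositionalEquality using (_≡_; refl)

skew? : (λ′ μ : List ℕ) → Decidable (Skew λ′ μ)
skew? λ′ μ i j = (row μ i ≤? j) ×-dec (j <? row λ′ i)

module _ {B : BoxSet} (B? : Decidable B) where

  NWNeighbour? : Decidable (NWNeighbour B)
  NWNeighbour? zero    _       = no λ ()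
  NWNeighbour? (suc i) zero    = no λ ()
  NWNeighbour? (suc i) (suc j) = B? i j

  nw₁? : Decidable (nw₁ B)
  nw₁? i j = B? i j ×-dec ¬? (NWNeighbour? i j)

  nw₂-northwest : ∀ {i j} → nw B 2 (suc i) (suc j) → nw B 1 i j
  nw₂-northwest ((B₊ , ¬nw₁₊) , ¬remaining₁) = decidable-stable (nw₁? _ _) λ ¬nw₁ →
    ¬remaining₁ (decidable-stable (B? _ _) (λ ¬B → ¬nw₁₊ (B₊ , ¬B)) , ¬nw₁)

remaining? : {B : BoxSet} → Decidable B → ∀ k → Decidable (remaining B k)
remaining? B? zero    = B?
remaining? B? (suc k) i j = remaining? B? k i j ×-dec ¬? (nw₁? (remaining? B? k) i j)

remaining⊆ : {B : BoxSet} → ∀ k {i j} → remaining B k i j → B i j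
remaining⊆ zero    r = r
remaining⊆ (suc k) r = remaining⊆ k (proj₁ r)

nw⊆ : {B : BoxSet} → ∀ k {i j} → nw B (suc k) i j → B i j
nw⊆ k h = remaining⊆ k (proj₁ h)

-- nw B (2 + k) and nw B (1 + k) are nw₂ and nw₁ of remaining B k, definitionally.
nw-northwest : {B : BoxSet} → Decidable B → ∀ k {i j} →
               nw B (suc (suc k)) (suc i) (suc j) → nw B (suc k) i j
nw-northwest B? k = nw₂-northwest (remaining? B? k)

lemma4p8 : (λ′ μ : List ℕ) → IsPartition λ′ → IsPartition μ → μ ⊆ᵖ λ′ →
    (i j a : ℕ) → Skew λ′ μ (suc i) (suc j) → H≡ (Skew λ′ μ) (suc i) (suc j) a → 1 < a →
      Skew λ′ μ i j × Σ ℕ (λ b → H≡ (Skew λ′ μ) i j b × a ≡ suc b)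
lemma4p8 λ′ μ _ _ _ i j (suc (suc k)) _ h _ = nw⊆ k h-northwest , suc k , h-northwest , refl
  where
  h-northwest : nw (Skew λ′ μ) (suc k) i j
  h-northwest = nw-northwest (skew? λ′ μ) k h
lemma4p8 _ _ _ _ _ _ _ (suc zero) _ _ (s≤s ())
lemma4p8 _ _ _ _ _ _ _ zero _ () _
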